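{- For every $n\in\mathbb{N}$ and every $r>6$, the graph $G(3,n)$ contains no induced cycle of length $r$.
   Context: For a prime $p$ and $n\in\mathbb{N}$, $G(p,n)$ is the simple graph with vertex set $\{2,4,\ldots,2n\}$ in which two distinct vertices $a,b$ are adjacent if and only if both $\frac{a+b}{2}$ and $\frac{|a-b|}{2}$ are odd positive integers neither of which equals $pk$ for an integer $k\ge 2$. -}

module Defs where

open import Data.Nat using (ℕ; zero; suc; _+_; _*_; _≤_; _<_; _/_; _%_; ∣_-_∣)
open import Data.Nat.Divisibility using (_∣_)
open import Data.Fin using (Fin; toℕ)
open import Data.Product using (_×_; ∃-syntax)
open import Data.Sum using (_⊎_)
open import Relation.Nullary using (¬_)
open import Relation.Binary.PropositionalEquality using (_≡_; _≢_)
open import Function.Bundles using (_⇔_)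
open import Function.Definitions using (Injective)

OddPos : ℕ → Set
OddPos m = (m % 2 ≡ 1)

IsBigMultiple : ℕ → ℕ → Set
IsBigMultiple p m = ∃[ k ] (2 ≤ k × m ≡ p * k)

IsVertex : ℕ → ℕ → Set
IsVertex n v = 2 ∣ v × 2 ≤ v × v ≤ 2 * n

Adj : ℕ → ℕ → ℕ → Set
Adj p a b =
  a ≢ b ×
  OddPos ((a + b) / 2) × OddPos (∣ a - b ∣ / 2) ×
  ¬ IsBigMultiple p ((a + b) / 2) × ¬ IsBigMultiple p (∣ a - b ∣ / 2)

CycAdj : (r : ℕ) → Fin r → Fin r → Set
CycAdj r i j =
  suc (toℕ i) ≡ toℕ j ⊎ suc (toℕ j) ≡ toℕ i ⊎
  (toℕ i ≡ 0 × suc (toℕ j) ≡ r) ⊎ (toℕ j ≡ 0 × suc (toℕ i) ≡ r)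

HasInducedCycle : (p n r : ℕ) → Set
HasInducedCycle p n r =
  ∃[ f ] ( Injective _≡_ _≡_ f
         × (∀ i → IsVertex n (f i))
         × (∀ i j → Adj p (f i) (f j) ⇔ CycAdj r i j) )

-- Halve the vertices: 2x ~ 2y in G(3, n) iff x + y is odd and neither x + y nor |x - y| is
-- 3k with k ≥ 2.  Adjacent vertices have opposite parity, so if 3 ∣ x, 3 ∤ y and x + y is odd
-- then x ~ y.  On six consecutive vertices x₁ … x₆ of an induced cycle of length ≥ 7 the pairs
-- x₁x₄, x₃x₆, x₁x₆ are non-edges joining vertices of opposite parity; if 3 ∣ x₃ and 3 ∤ x₄, one of
-- them would join a multiple of 3 to a non-multiple.  Hence either every vertex is a multiple
-- of 3, which is impossible since the sum of two positive multiples of 3 is 3k with k ≥ 2, or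
-- none is.  In the latter case, for the largest vertex x and either neighbour y, 3 divides x + y
-- or x - y, forcing x + y = 3 or x - y = 3, i.e. y = |x - 3|: the two neighbours coincide.
module Submission where

open import Defs
open import Data.Nat using (ℕ; _<_; NonZero; >-nonZero; zero; suc; _+_; _*_; _∸_; _≤_; _%_; ∣_-_∣; z≤n; s≤s)
open import Relation.Nullary using (¬_; Dec; yes; no)

open import Data.Empty using (⊥; ⊥-elim)
open import Data.Fin using (Fin; toℕ; zero)
open import Data.Fin.Properties using (toℕ<n; toℕ-fromℕ<; toℕ-injective)
open import Data.List using (allFin)
open import Data.List.Extrema.Nat using (argmax; f[xs]≤f[argmax])
open import Data.List.Membership.Propositional.Properties using (∈-allFin)
import Data.List.Relation.Unary.All as All
open import Data.Nat.DivMod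
open import Data.Nat.Divisibility
  using (_∣_; _∤_; divides; _∣?_; ∣-refl; ∣m+n∣m⇒∣n; ∣m∸n∣n⇒∣m; m%n≡0⇒n∣m; ∣⇒≤)
open import Data.Nat.Properties
open import Data.Nat.Tactic.RingSolver using (solve-∀)
open import Data.Product using (_,_; proj₁; proj₂)
open import Data.Sum using (_⊎_; inj₁; inj₂)
open import Function.Base using (_∘_)
open import Function.Bundles using (_⇔_; mk⇔; Equivalence)
open import Relation.Binary.PropositionalEquality

odd-sum-path : ∀ a b c d → OddPos (a + b) → OddPos (b + c) → OddPos (c + d) → OddPos (a + d)
odd-sum-path a b c d ab bc cd = begin
  (a + d) % 2                                         ≡⟨ sym ([m+kn]%n≡m%n (a + d) (b + c) 2) ⟩
  (a + d + (b + c) * 2) % 2                           ≡⟨ cong (_% 2) (regroup a b c d) ⟩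
  (a + b + (b + c) + (c + d)) % 2                     ≡⟨ %-distribˡ-+ (a + b + (b + c)) (c + d) 2 ⟩
  ((a + b + (b + c)) % 2 + (c + d) % 2) % 2           ≡⟨ cong (λ s → (s + (c + d) % 2) % 2) (%-distribˡ-+ (a + b) (b + c) 2) ⟩
  (((a + b) % 2 + (b + c) % 2) % 2 + (c + d) % 2) % 2 ≡⟨ cong₂ (λ s t → ((s + t) % 2 + (c + d) % 2) % 2) ab bc ⟩
  (0 + (c + d) % 2) % 2                               ≡⟨ cong (_% 2) cd ⟩
  1                                                   ∎
  where
  open ≡-Reasoning
  regroup : ∀ a b c d → a + d + (b + c) * 2 ≡ a + b + (b + c) + (c + d)
  regroup = solve-∀

n≤m⇒[m+n]%2≡∣m-n∣%2 : ∀ {m n} → n ≤ m → (m + n) % 2 ≡ ∣ m - n ∣ % 2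
n≤m⇒[m+n]%2≡∣m-n∣%2 {m} {n} n≤m = begin
  (m + n) % 2           ≡⟨ cong (λ k → (k + n) % 2) (sym (m∸n+n≡m n≤m)) ⟩
  (m ∸ n + n + n) % 2   ≡⟨ cong (_% 2) (double (m ∸ n) n) ⟩
  (m ∸ n + n * 2) % 2   ≡⟨ [m+kn]%n≡m%n (m ∸ n) n 2 ⟩
  (m ∸ n) % 2           ≡⟨ cong (_% 2) (sym (m≤n⇒∣n-m∣≡n∸m n≤m)) ⟩
  ∣ m - n ∣ % 2         ∎
  where
  open ≡-Reasoning
  double : ∀ k n → k + n + n ≡ k + n * 2
  double = solve-∀

[m+n]%2≡∣m-n∣%2 : ∀ m n → (m + n) % 2 ≡ ∣ m - n ∣ % 2
[m+n]%2≡∣m-n∣%2 m n with ≤-total n m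
... | inj₁ n≤m = n≤m⇒[m+n]%2≡∣m-n∣%2 n≤m
... | inj₂ m≤n = begin
  (m + n) % 2     ≡⟨ cong (_% 2) (+-comm m n) ⟩
  (n + m) % 2     ≡⟨ n≤m⇒[m+n]%2≡∣m-n∣%2 m≤n ⟩
  ∣ n - m ∣ % 2   ≡⟨ cong (_% 2) (∣-∣-comm n m) ⟩
  ∣ m - n ∣ % 2   ∎
  where open ≡-Reasoning

∣m∣∣m-n∣⇒∣n : ∀ {d m n} → d ∣ m → d ∣ ∣ m - n ∣ → d ∣ n
∣m∣∣m-n∣⇒∣n {d} {m} {n} d∣m d∣∣m-n∣ with ≤-total n m
... | inj₁ n≤m = ∣m+n∣m⇒∣n (subst (d ∣_) (sym (m∸n+n≡m n≤m)) d∣m)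
                           (subst (d ∣_) (m≤n⇒∣n-m∣≡n∸m n≤m) d∣∣m-n∣)
... | inj₂ m≤n = ∣m∸n∣n⇒∣m d m≤n (subst (d ∣_) (m≤n⇒∣m-n∣≡n∸m m≤n) d∣∣m-n∣) d∣m

m%d≡n%d⇒d∣∣m-n∣ : ∀ m n {d} .{{_ : NonZero d}} → m % d ≡ n % d → d ∣ ∣ m - n ∣
m%d≡n%d⇒d∣∣m-n∣ m n {d} m%d≡n%d = divides ∣ m / d - n / d ∣ (begin
  ∣ m - n ∣                                   ≡⟨ cong₂ ∣_-_∣ (m≡m%n+[m/n]*n m d) (m≡m%n+[m/n]*n n d) ⟩
  ∣ m % d + m / d * d - n % d + n / d * d ∣   ≡⟨ cong (λ r → ∣ m % d + m / d * d - r + n / d * d ∣) (sym m%d≡n%d) ⟩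
  ∣ m % d + m / d * d - m % d + n / d * d ∣   ≡⟨ ∣m+n-m+o∣≡∣n-o∣ (m % d) (m / d * d) (n / d * d) ⟩
  ∣ m / d * d - n / d * d ∣                   ≡⟨ sym (*-distribʳ-∣-∣ d (m / d) (n / d)) ⟩
  ∣ m / d - n / d ∣ * d                       ∎)
  where open ≡-Reasoning

[e+m]%n≢m%n : ∀ {e n} m .{{_ : NonZero n}} → 0 < e → e < n → (e + m) % n ≢ m % n
[e+m]%n≢m%n {e} {n} m 0<e e<n [e+m]%n≡m%n = <⇒≱ e<n (∣⇒≤ {{>-nonZero 0<e}} n∣e)
  where
  ∣e+m-m∣≡e : ∣ e + m - m ∣ ≡ e
  ∣e+m-m∣≡e = trans (∣-∣-comm (e + m) m) (trans (cong (∣ m -_∣) (+-comm e m)) (∣m-m+n∣≡n m e))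
  n∣e : n ∣ e
  n∣e = subst (n ∣_) ∣e+m-m∣≡e (m%d≡n%d⇒d∣∣m-n∣ (e + m) m [e+m]%n≡m%n)

[m+n%d]%d≡[m+n]%d : ∀ m n d .{{_ : NonZero d}} → (m + n % d) % d ≡ (m + n) % d
[m+n%d]%d≡[m+n]%d m n d = begin
  (m + n % d) % d           ≡⟨ %-distribˡ-+ m (n % d) d ⟩
  (m % d + n % d % d) % d   ≡⟨ cong (λ r → (m % d + r) % d) (m%n%n≡m%n n d) ⟩
  (m % d + n % d) % d       ≡⟨ sym (%-distribˡ-+ m n d) ⟩
  (m + n) % d               ∎
  where open ≡-Reasoning

3∣m⊎3∣n⊎3∣m+n⊎3∣∣m-n∣ : ∀ m n → 3 ∣ m ⊎ 3 ∣ n ⊎ 3 ∣ m + n ⊎ 3 ∣ ∣ m - n ∣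
3∣m⊎3∣n⊎3∣m+n⊎3∣∣m-n∣ m n = by-residues (m % 3) (n % 3) refl refl (m%n<n m 3) (m%n<n n 3)
  where
  [m+n]%3≡ : ∀ {a b} → m % 3 ≡ a → n % 3 ≡ b → (m + n) % 3 ≡ (a + b) % 3
  [m+n]%3≡ m≡a n≡b = trans (%-distribˡ-+ m n 3) (cong₂ (λ a b → (a + b) % 3) m≡a n≡b)
  by-residues : ∀ a b → m % 3 ≡ a → n % 3 ≡ b → a < 3 → b < 3 →
                3 ∣ m ⊎ 3 ∣ n ⊎ 3 ∣ m + n ⊎ 3 ∣ ∣ m - n ∣
  by-residues 0 _ m≡a _   _ _ = inj₁ (m%n≡0⇒n∣m m 3 m≡a)
  by-residues _ 0 _   n≡b _ _ = inj₂ (inj₁ (m%n≡0⇒n∣m n 3 n≡b))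
  by-residues 1 2 m≡a n≡b _ _ = inj₂ (inj₂ (inj₁ (m%n≡0⇒n∣m (m + n) 3 ([m+n]%3≡ m≡a n≡b))))
  by-residues 2 1 m≡a n≡b _ _ = inj₂ (inj₂ (inj₁ (m%n≡0⇒n∣m (m + n) 3 ([m+n]%3≡ m≡a n≡b))))
  by-residues 1 1 m≡a n≡b _ _ = inj₂ (inj₂ (inj₂ (m%d≡n%d⇒d∣∣m-n∣ m n (trans m≡a (sym n≡b)))))
  by-residues 2 2 m≡a n≡b _ _ = inj₂ (inj₂ (inj₂ (m%d≡n%d⇒d∣∣m-n∣ m n (trans m≡a (sym n≡b)))))
  by-residues (suc (suc (suc _))) _ _ _ (s≤s (s≤s (s≤s ()))) _
  by-residues _ (suc (suc (suc _))) _ _ _ (s≤s (s≤s (s≤s ())))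

IsBigMultiple⇒∣ : ∀ {p m} → IsBigMultiple p m → p ∣ m
IsBigMultiple⇒∣ {p} (k , _ , m≡p*k) = divides k (trans m≡p*k (*-comm p k))

∣-OddPos-¬IsBigMultiple⇒≡ : ∀ {p m} → p ∣ m → OddPos m → ¬ IsBigMultiple p m → m ≡ p
∣-OddPos-¬IsBigMultiple⇒≡ (divides zero refl) () _
∣-OddPos-¬IsBigMultiple⇒≡ {p} (divides 1 refl) _ _ = +-identityʳ p
∣-OddPos-¬IsBigMultiple⇒≡ {p} (divides (suc (suc k)) refl) _ ¬big =
  ⊥-elim (¬big (suc (suc k) , s≤s (s≤s z≤n) , *-comm (suc (suc k)) p))

record HalfAdj (p x y : ℕ) : Set where
  field
    distinct     : x ≢ y
    odd-sum      : OddPos (x + y)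
    odd-diff     : OddPos ∣ x - y ∣
    sum-not-big  : ¬ IsBigMultiple p (x + y)
    diff-not-big : ¬ IsBigMultiple p ∣ x - y ∣

open HalfAdj

HalfAdj-sym : ∀ {p x y} → HalfAdj p x y → HalfAdj p y x
HalfAdj-sym {p} {x} {y} e = record
  { distinct     = λ y≡x → distinct e (sym y≡x)
  ; odd-sum      = subst OddPos (+-comm x y) (odd-sum e)
  ; odd-diff     = subst OddPos (∣-∣-comm x y) (odd-diff e)
  ; sum-not-big  = λ big → sum-not-big e (subst (IsBigMultiple p) (+-comm y x) big)
  ; diff-not-big = λ big → diff-not-big e (subst (IsBigMultiple p) (∣-∣-comm y x) big)
  }

Adj-double⇔HalfAdj : ∀ p x y → Adj p (x * 2) (y * 2) ⇔ HalfAdj p x y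
Adj-double⇔HalfAdj p x y = mk⇔
  (λ (x≢y , odd₁ , odd₂ , ¬big₁ , ¬big₂) → record
    { distinct     = λ x≡y → x≢y (cong (_* 2) x≡y)
    ; odd-sum      = subst OddPos halve-sum odd₁
    ; odd-diff     = subst OddPos halve-diff odd₂
    ; sum-not-big  = λ big → ¬big₁ (subst (IsBigMultiple p) (sym halve-sum) big)
    ; diff-not-big = λ big → ¬big₂ (subst (IsBigMultiple p) (sym halve-diff) big)
    })
  (λ e →
    (λ 2x≡2y → distinct e (*-cancelʳ-≡ x y 2 2x≡2y)) ,
    subst OddPos (sym halve-sum) (odd-sum e) ,
    subst OddPos (sym halve-diff) (odd-diff e) ,
    (λ big → sum-not-big e (subst (IsBigMultiple p) halve-sum big)) ,
    (λ big → diff-not-big e (subst (IsBigMultiple p) halve-diff big)))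
  where
  halve-sum : (x * 2 + y * 2) / 2 ≡ x + y
  halve-sum = trans (cong (_/ 2) (sym (*-distribʳ-+ 2 x y))) (m*n/n≡m (x + y) 2)
  halve-diff : ∣ x * 2 - y * 2 ∣ / 2 ≡ ∣ x - y ∣
  halve-diff = trans (cong (_/ 2) (sym (*-distribʳ-∣-∣ 2 x y))) (m*n/n≡m ∣ x - y ∣ 2)

∣∧∤⇒HalfAdj : ∀ {p x y} → OddPos (x + y) → p ∣ x → p ∤ y → HalfAdj p x y
∣∧∤⇒HalfAdj {p} {x} {y} odd p∣x p∤y = record
  { distinct     = λ x≡y → p∤y (subst (p ∣_) x≡y p∣x)
  ; odd-sum      = odd
  ; odd-diff     = trans (sym ([m+n]%2≡∣m-n∣%2 x y)) odd
  ; sum-not-big  = λ big → p∤y (∣m+n∣m⇒∣n (IsBigMultiple⇒∣ big) p∣x)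
  ; diff-not-big = λ big → p∤y (∣m∣∣m-n∣⇒∣n p∣x (IsBigMultiple⇒∣ big))
  }

∣∧∣⇒¬HalfAdj : ∀ {p x y} → 1 ≤ x → 1 ≤ y → p ∣ x → p ∣ y → ¬ HalfAdj p x y
∣∧∣⇒¬HalfAdj () _ (divides zero refl) _
∣∧∣⇒¬HalfAdj _ () _ (divides zero refl)
∣∧∣⇒¬HalfAdj {p} _ _ (divides (suc a) refl) (divides (suc b) refl) e =
  sum-not-big e (suc a + suc b , 2≤a+b , trans (sym (*-distribʳ-+ p (suc a) (suc b))) (*-comm (suc a + suc b) p))
  where
  2≤a+b : 2 ≤ suc a + suc b
  2≤a+b = s≤s (≤-trans (s≤s z≤n) (m≤n+m (suc b) a))

divisibility-switch-impossible :
  ∀ {p x₁ x₂ x₃ x₄ x₅ x₆} →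
  HalfAdj p x₁ x₂ → HalfAdj p x₂ x₃ → HalfAdj p x₃ x₄ → HalfAdj p x₄ x₅ → HalfAdj p x₅ x₆ →
  ¬ HalfAdj p x₁ x₄ → ¬ HalfAdj p x₃ x₆ → ¬ HalfAdj p x₁ x₆ →
  p ∣ x₃ → p ∤ x₄ → ⊥
divisibility-switch-impossible {p} {x₁} {x₂} {x₃} {x₄} {x₅} {x₆}
  e₁₂ e₂₃ e₃₄ e₄₅ e₅₆ ¬e₁₄ ¬e₃₆ ¬e₁₆ p∣x₃ p∤x₄ = by-cases (p ∣? x₁) (p ∣? x₆)
  where
  odd₁₄ : OddPos (x₁ + x₄)
  odd₁₄ = odd-sum-path x₁ x₂ x₃ x₄ (odd-sum e₁₂) (odd-sum e₂₃) (odd-sum e₃₄)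
  odd₃₆ : OddPos (x₃ + x₆)
  odd₃₆ = odd-sum-path x₃ x₄ x₅ x₆ (odd-sum e₃₄) (odd-sum e₄₅) (odd-sum e₅₆)
  odd₆₁ : OddPos (x₆ + x₁)
  odd₆₁ = subst OddPos (+-comm x₁ x₆) (odd-sum-path x₁ x₄ x₅ x₆ odd₁₄ (odd-sum e₄₅) (odd-sum e₅₆))
  by-cases : Dec (p ∣ x₁) → Dec (p ∣ x₆) → ⊥
  by-cases (yes p∣x₁) _          = ¬e₁₄ (∣∧∤⇒HalfAdj odd₁₄ p∣x₁ p∤x₄)
  by-cases (no p∤x₁)  (yes p∣x₆) = ¬e₁₆ (HalfAdj-sym (∣∧∤⇒HalfAdj odd₆₁ p∣x₆ p∤x₁))
  by-cases (no _)     (no p∤x₆)  = ¬e₃₆ (∣∧∤⇒HalfAdj odd₃₆ p∣x₃ p∤x₆)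

HalfAdj₃-lower≡∣-3∣ : ∀ {x y} → HalfAdj 3 x y → y < x → 3 ∤ x → 3 ∤ y → y ≡ ∣ x - 3 ∣
HalfAdj₃-lower≡∣-3∣ {x} {y} e y<x 3∤x 3∤y with 3∣m⊎3∣n⊎3∣m+n⊎3∣∣m-n∣ x y
... | inj₁ 3∣x = ⊥-elim (3∤x 3∣x)
... | inj₂ (inj₁ 3∣y) = ⊥-elim (3∤y 3∣y)
... | inj₂ (inj₂ (inj₁ 3∣x+y)) = begin
  y               ≡⟨ sym (∣m-m+n∣≡n x y) ⟩
  ∣ x - x + y ∣   ≡⟨ cong (∣ x -_∣) (∣-OddPos-¬IsBigMultiple⇒≡ 3∣x+y (odd-sum e) (sum-not-big e)) ⟩
  ∣ x - 3 ∣       ∎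
  where open ≡-Reasoning
... | inj₂ (inj₂ (inj₂ 3∣∣x-y∣)) = begin
  y               ≡⟨ sym (∣m-m+n∣≡n 3 y) ⟩
  ∣ 3 - 3 + y ∣   ≡⟨ ∣-∣-comm 3 (3 + y) ⟩
  ∣ 3 + y - 3 ∣   ≡⟨ cong ∣_- 3 ∣ 3+y≡x ⟩
  ∣ x - 3 ∣       ∎
  where
  open ≡-Reasoning
  x∸y≡3 : x ∸ y ≡ 3
  x∸y≡3 = trans (sym (m≤n⇒∣n-m∣≡n∸m (<⇒≤ y<x)))
                (∣-OddPos-¬IsBigMultiple⇒≡ 3∣∣x-y∣ (odd-diff e) (diff-not-big e))
  3+y≡x : 3 + y ≡ x
  3+y≡x = trans (cong (_+ y) (sym x∸y≡3)) (m∸n+n≡m (<⇒≤ y<x))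

-- The halved vertices of an induced cycle of length ≥ 7, read around the cycle again and
-- again.  The maximum is placed at index 3 + peak so that the windows of six consecutive
-- indices around it start at a natural number.
record InducedWalk (p : ℕ) : Set where
  field
    vertex    : ℕ → ℕ
    positive  : ∀ m → 1 ≤ vertex m
    adjacent  : ∀ m → HalfAdj p (vertex m) (vertex (1 + m))
    no-chord₃ : ∀ m → ¬ HalfAdj p (vertex m) (vertex (3 + m))
    no-chord₅ : ∀ m → ¬ HalfAdj p (vertex m) (vertex (5 + m))
    distinct₂ : ∀ m → vertex m ≢ vertex (2 + m)
    peak      : ℕ
    peak-max  : ∀ m → vertex m ≤ vertex (3 + peak)

module _ {p : ℕ} (walk : InducedWalk p) where
  open InducedWalk walk

  no-switch-forward : ∀ t → p ∣ vertex (2 + t) → p ∤ vertex (3 + t) → ⊥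
  no-switch-forward t =
    divisibility-switch-impossible
      (adjacent t) (adjacent (1 + t)) (adjacent (2 + t)) (adjacent (3 + t)) (adjacent (4 + t))
      (no-chord₃ t) (no-chord₃ (2 + t)) (no-chord₅ t)

  no-switch-backward : ∀ t → p ∣ vertex (3 + t) → p ∤ vertex (2 + t) → ⊥
  no-switch-backward t =
    divisibility-switch-impossible
      (HalfAdj-sym (adjacent (4 + t))) (HalfAdj-sym (adjacent (3 + t))) (HalfAdj-sym (adjacent (2 + t)))
      (HalfAdj-sym (adjacent (1 + t))) (HalfAdj-sym (adjacent t))
      (no-chord₃ (2 + t) ∘ HalfAdj-sym) (no-chord₃ t ∘ HalfAdj-sym) (no-chord₅ t ∘ HalfAdj-sym)

¬InducedWalk₃ : ¬ InducedWalk 3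
¬InducedWalk₃ walk = by-cases (3 ∣? top) (3 ∣? left) (3 ∣? right)
  where
  open InducedWalk walk
  top left right : ℕ
  top   = vertex (3 + peak)
  left  = vertex (2 + peak)
  right = vertex (4 + peak)
  left<top : left < top
  left<top = ≤∧≢⇒< (peak-max (2 + peak)) (distinct (adjacent (2 + peak)))
  right<top : right < top
  right<top = ≤∧≢⇒< (peak-max (4 + peak)) (distinct (adjacent (3 + peak)) ∘ sym)
  by-cases : Dec (3 ∣ top) → Dec (3 ∣ left) → Dec (3 ∣ right) → ⊥
  by-cases (yes 3∣top) (yes 3∣left) _ =
    ∣∧∣⇒¬HalfAdj (positive (2 + peak)) (positive (3 + peak)) 3∣left 3∣top (adjacent (2 + peak))
  by-cases (yes 3∣top) (no 3∤left) _       = no-switch-backward walk peak 3∣top 3∤left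
  by-cases (no 3∤top) (yes 3∣left) _       = no-switch-forward walk peak 3∣left 3∤top
  by-cases (no 3∤top) (no _) (yes 3∣right) = no-switch-backward walk (1 + peak) 3∣right 3∤top
  by-cases (no 3∤top) (no 3∤left) (no 3∤right) = distinct₂ (2 + peak) (begin
    left        ≡⟨ HalfAdj₃-lower≡∣-3∣ (HalfAdj-sym (adjacent (2 + peak))) left<top 3∤top 3∤left ⟩
    ∣ top - 3 ∣ ≡⟨ HalfAdj₃-lower≡∣-3∣ (adjacent (3 + peak)) right<top 3∤top 3∤right ⟨
    right       ∎)
    where open ≡-Reasoning

module _ {R : ℕ} .{{_ : NonZero R}} where

  private
    successor-inside : ∀ {a b : Fin R} → suc (toℕ a) ≡ toℕ b → suc (toℕ a) % R ≡ toℕ b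
    successor-inside {a} {b} a+1≡b = trans (m<n⇒m%n≡m (subst (_< R) (sym a+1≡b) (toℕ<n b))) a+1≡b

    successor-wraps : ∀ {a b : Fin R} → suc (toℕ a) ≡ R → toℕ b ≡ 0 → suc (toℕ a) % R ≡ toℕ b
    successor-wraps a+1≡R b≡0 = trans (cong (_% R) a+1≡R) (trans (n%n≡0 R) (sym b≡0))

  CycAdj⇒successor : ∀ {i j : Fin R} → CycAdj R i j → suc (toℕ i) % R ≡ toℕ j ⊎ suc (toℕ j) % R ≡ toℕ i
  CycAdj⇒successor (inj₁ i+1≡j)                       = inj₁ (successor-inside i+1≡j)
  CycAdj⇒successor (inj₂ (inj₁ j+1≡i))                = inj₂ (successor-inside j+1≡i)
  CycAdj⇒successor (inj₂ (inj₂ (inj₁ (i≡0 , j+1≡R)))) = inj₂ (successor-wraps j+1≡R i≡0)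
  CycAdj⇒successor (inj₂ (inj₂ (inj₂ (j≡0 , i+1≡R)))) = inj₁ (successor-wraps i+1≡R j≡0)

  successor⇒CycAdj : ∀ {i j : Fin R} → suc (toℕ i) % R ≡ toℕ j → CycAdj R i j
  successor⇒CycAdj {i} i+1≡j with m≤n⇒m<n∨m≡n (toℕ<n i)
  ... | inj₁ i+1<R = inj₁ (trans (sym (m<n⇒m%n≡m i+1<R)) i+1≡j)
  ... | inj₂ i+1≡R = inj₂ (inj₂ (inj₂ (trans (sym i+1≡j) (trans (cong (_% R) i+1≡R) (n%n≡0 R)) , i+1≡R)))

  toℕ-mod : ∀ m → toℕ (m mod R) ≡ m % R
  toℕ-mod m = toℕ-fromℕ< (m%n<n m R)

  suc-toℕ-mod : ∀ m → suc (toℕ (m mod R)) % R ≡ suc m % R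
  suc-toℕ-mod m = trans (cong (λ r → suc r % R) (toℕ-mod m)) ([m+n%d]%d≡[m+n]%d 1 m R)

  CycAdj-mod-suc : ∀ m → CycAdj R (m mod R) (suc m mod R)
  CycAdj-mod-suc m = successor⇒CycAdj (trans (suc-toℕ-mod m) (sym (toℕ-mod (suc m))))

  mod-+-≢ : ∀ {e} m → 0 < e → e < R → m mod R ≢ (e + m) mod R
  mod-+-≢ {e} m 0<e e<R eq = [e+m]%n≢m%n m 0<e e<R
    (trans (sym (toℕ-mod (e + m))) (trans (cong toℕ (sym eq)) (toℕ-mod m)))

  ¬CycAdj-mod-+ : ∀ {d} m → 2 ≤ d → 1 + d < R → ¬ CycAdj R (m mod R) ((d + m) mod R)
  ¬CycAdj-mod-+ {suc (suc d)} m (s≤s (s≤s _)) 3+d<R adj with CycAdj⇒successor adj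
  ... | inj₁ forward = [e+m]%n≢m%n (suc m) (s≤s z≤n) (≤-trans (m≤n+m (2 + d) 2) 3+d<R) (begin
    (suc d + suc m) % R           ≡⟨ cong (λ r → suc r % R) (+-suc d m) ⟩
    (2 + d + m) % R               ≡⟨ toℕ-mod (2 + d + m) ⟨
    toℕ ((2 + d + m) mod R)       ≡⟨ forward ⟨
    suc (toℕ (m mod R)) % R       ≡⟨ suc-toℕ-mod m ⟩
    suc m % R                     ∎)
    where open ≡-Reasoning
  ... | inj₂ backward = [e+m]%n≢m%n m (s≤s z≤n) 3+d<R (begin
    (3 + d + m) % R                     ≡⟨ suc-toℕ-mod (2 + d + m) ⟨
    suc (toℕ ((2 + d + m) mod R)) % R   ≡⟨ backward ⟩
    toℕ (m mod R)                       ≡⟨ toℕ-mod m ⟩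
    m % R                               ∎)
    where open ≡-Reasoning

inducedCycle⇒walk : ∀ {p} n k → HasInducedCycle p n (7 + k) → InducedWalk p
inducedCycle⇒walk {p} n k (f , f-injective , f-vertex , f-adj) = record
  { vertex    = vertex
  ; positive  = λ m → half-positive (m mod R)
  ; adjacent  = λ m → edge (CycAdj-mod-suc m)
  ; no-chord₃ = λ m → ¬CycAdj-mod-+ m (s≤s (s≤s z≤n)) (m≤m+n 5 (2 + k)) ∘ edge⁻¹
  ; no-chord₅ = λ m → ¬CycAdj-mod-+ m (s≤s (s≤s z≤n)) (m≤m+n 7 k) ∘ edge⁻¹
  ; distinct₂ = λ m → mod-+-≢ m (s≤s z≤n) (m≤m+n 3 (4 + k)) ∘ half-injective
  ; peak      = 4 + k + toℕ top
  ; peak-max  = λ m → subst (vertex m ≤_) (cong half (sym R+top-mod)) (half-max (m mod R))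
  }
  where
  R : ℕ
  R = 7 + k
  half : Fin R → ℕ
  half i = _∣_.quotient (proj₁ (f-vertex i))
  f≡half*2 : ∀ i → f i ≡ half i * 2
  f≡half*2 i = _∣_.equality (proj₁ (f-vertex i))
  half-positive : ∀ i → 1 ≤ half i
  half-positive i = *-cancelʳ-≤ 1 (half i) 2 (subst (2 ≤_) (f≡half*2 i) (proj₁ (proj₂ (f-vertex i))))
  half-injective : ∀ {i j} → half i ≡ half j → i ≡ j
  half-injective {i} {j} eq = f-injective (trans (f≡half*2 i) (trans (cong (_* 2) eq) (sym (f≡half*2 j))))
  edge : ∀ {i j} → CycAdj R i j → HalfAdj p (half i) (half j)
  edge {i} {j} c = Equivalence.to (Adj-double⇔HalfAdj p (half i) (half j))
    (subst₂ (Adj p) (f≡half*2 i) (f≡half*2 j) (Equivalence.from (f-adj i j) c))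
  edge⁻¹ : ∀ {i j} → HalfAdj p (half i) (half j) → CycAdj R i j
  edge⁻¹ {i} {j} e = Equivalence.to (f-adj i j)
    (subst₂ (Adj p) (sym (f≡half*2 i)) (sym (f≡half*2 j)) (Equivalence.from (Adj-double⇔HalfAdj p (half i) (half j)) e))
  vertex : ℕ → ℕ
  vertex m = half (m mod R)
  top : Fin R
  top = argmax half zero (allFin R)
  half-max : ∀ i → half i ≤ half top
  half-max i = All.lookup (f[xs]≤f[argmax] {f = half} zero (allFin R)) (∈-allFin i)
  R+top-mod : (R + toℕ top) mod R ≡ top
  R+top-mod = toℕ-injective (begin
    toℕ ((R + toℕ top) mod R) ≡⟨ toℕ-mod (R + toℕ top) ⟩
    (R + toℕ top) % R         ≡⟨ %-remove-+ˡ (toℕ top) (∣-refl {R}) ⟩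
    toℕ top % R               ≡⟨ m<n⇒m%n≡m (toℕ<n top) ⟩
    toℕ top                   ∎)
    where open ≡-Reasoning

proposition4p5 : (n r : ℕ) → 6 < r → ¬ HasInducedCycle 3 n r
proposition4p5 n r 6<r =
  ¬InducedWalk₃ ∘ inducedCycle⇒walk n (r ∸ 7) ∘ subst (HasInducedCycle 3 n) (sym (m+[n∸m]≡n 6<r))
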